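{- Let $\lambda\supseteq\mu$ be strict partitions such that the shifted skew diagram $\widetilde{\lambda/\mu}$ has $n$ boxes and contains the three boxes $(i,j)$, $(i,j+1)$ and $(i+1,j+1)$ for some $i,j$. If $Q_{\lambda/\mu}=\sum_{\nu\in OP(n)}a_\nu p_\nu$, then $\sum_{\nu\in OP(n)}a_\nu=0$.
   Context: Boxes are indexed $(i,j)$ with row $i$ from the top and column $j$ from the left. For strict partitions $\mu\subseteq\lambda$ ($\mu_i=0$ for $i>\ell(\mu)$), $\widetilde{\lambda/\mu}=\{(i,j):1\le i\le\ell(\lambda),\ i+\mu_i\le j\le i+\lambda_i-1\}$. With $\mathbf{P}'=\{1'<1<2'<2<\cdots\}$ and $|a|$ the unmarked version of $a$, a marked shifted tableau of shape $\widetilde{\lambda/\mu}$ is a filling by letters of $\mathbf{P}'$ with weakly increasing rows and columns, at most one unmarked $k$ per column and at most one $k'$ per row for each $k$; its content is $(c_1,c_2,\dots)$, $c_i=\#\{\text{entries }a:|a|=i\}$. $Q_{\lambda/\mu}=\sum_T x_1^{c_1}x_2^{c_2}\cdots$ over all such tableaux. $OP(n)$ is the set of partitions of $n$ into odd parts, $p_\nu=\prod_i p_{\nu_i}$ with $p_r=\sum_ix_i^r$; $Q_{\lambda/\mu}$ has a unique expansion in $\{p_\nu:\nu\in OP(n)\}$. -}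

module Defs where

open import Data.Nat using (ℕ; zero; suc; _+_; _∸_; _≤_; _<_; _≡ᵇ_; _<ᵇ_; _≤ᵇ_; _%_)
open import Data.Nat.ListAction using (sum)
open import Data.Bool using (Bool; true; false; _∧_; _∨_; not; if_then_else_)
open import Data.List using (List; []; _∷_; length; map; concatMap; filter; foldr; upTo)
open import Data.List.Relation.Unary.All using (All)
open import Data.List.Relation.Unary.Linked using (Linked)
open import Data.Product using (_×_; _,_; proj₁; proj₂)
open import Data.Integer using (+_)
open import Data.Rational using (ℚ; _/_; 0ℚ) renaming (_+_ to _+ℚ_)
open import Relation.Binary.PropositionalEquality using (_≡_)
open import Relation.Nullary.Decidable using (T?)
open import Data.Bool using (T)

-- Partitions (lists of parts, largest first)

nth : List ℕ → ℕ → ℕ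
nth []       _       = 0
nth (x ∷ xs) zero    = x
nth (x ∷ xs) (suc i) = nth xs i

-- 1-indexed part  μ_i  (μ_i = 0 for i > ℓ(μ), and part μ 0 = 0, unused)
part : List ℕ → ℕ → ℕ
part xs zero    = 0
part xs (suc i) = nth xs i

StrictPartition : List ℕ → Set
StrictPartition xs = Linked (λ x y → y < x) xs × All (λ x → 1 ≤ x) xs

_⊆ₚ_ : List ℕ → List ℕ → Set
mu ⊆ₚ la = ∀ i → part mu i ≤ part la i

IsOddPartition : ℕ → List ℕ → Set
IsOddPartition n nu =
  Linked (λ x y → y ≤ x) nu × All (λ x → x % 2 ≡ 1) nu × sum nu ≡ n

-- Shifted skew diagram  λ/μ~ = {(i,j) : 1 ≤ i ≤ ℓ(λ), i+μ_i ≤ j ≤ i+λ_i-1}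

InDiagram : List ℕ → List ℕ → ℕ → ℕ → Set
InDiagram la mu i j =
  1 ≤ i × i ≤ length la × i + part mu i ≤ j × j < i + part la i

Box : Set
Box = ℕ × ℕ

-- [a , b)
range : ℕ → ℕ → List ℕ
range a b = map (λ t → a + t) (upTo (b ∸ a))

boxes : List ℕ → List ℕ → List Box
boxes la mu =
  concatMap (λ i → map (λ j → (i , j)) (range (i + part mu i) (i + part la i)))
            (range 1 (suc (length la)))

size : List ℕ → List ℕ → ℕ
size la mu = length (boxes la mu)

-- Marked alphabet P' = {1' < 1 < 2' < 2 < ...}
-- a letter is (k , m) with k ≥ 1 the unmarked value |a| and m = true iff marked

Letter : Set
Letter = ℕ × Bool

val : Letter → ℕ
val = proj₁

marked : Letter → Bool
marked = proj₂

-- order on P':  k' < k < (k+1)'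
_≤L_ : Letter → Letter → Bool
(k , m) ≤L (k' , m') = (k <ᵇ k') ∨ ((k ≡ᵇ k') ∧ (m ∨ not m'))

letters : ℕ → List Letter
letters r = concatMap (λ k → (k , true) ∷ (k , false) ∷ []) (range 1 (suc r))

Filling : Set
Filling = List (Box × Letter)

fillings : List Box → List Letter → List Filling
fillings []       ls = [] ∷ []
fillings (b ∷ bs) ls = concatMap (λ F → map (λ a → (b , a) ∷ F) ls) (fillings bs ls)

allB : {A : Set} → (A → Bool) → List A → Bool
allB p = foldr (λ x r → p x ∧ r) true

pairOK : Box × Letter → Box × Letter → Bool
pairOK ((i , j) , a) ((i' , j') , b) =
     (not ((i ≡ᵇ i') ∧ (j ≤ᵇ j')) ∨ (a ≤L b))          -- rows weakly increase
  ∧ (not ((j ≡ᵇ j') ∧ (i ≤ᵇ i')) ∨ (a ≤L b))          -- columns weakly increase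
  ∧ not ((j ≡ᵇ j') ∧ not (i ≡ᵇ i') ∧ not (marked a) ∧ not (marked b)
          ∧ (val a ≡ᵇ val b))                           -- ≤ one unmarked k per column
  ∧ not ((i ≡ᵇ i') ∧ not (j ≡ᵇ j') ∧ marked a ∧ marked b
          ∧ (val a ≡ᵇ val b))                           -- ≤ one k' per row

isTableau : Filling → Bool
isTableau F = allB (λ p → allB (pairOK p) F) F

countB : {A : Set} → (A → Bool) → List A → ℕ
countB p []       = 0
countB p (x ∷ xs) = if p x then suc (countB p xs) else countB p xs

-- content of F equals c = (c_1,...,c_r)  (entries only use |a| ≤ r)
hasContent : List ℕ → Filling → Bool
hasContent c F =
  allB (λ k → countB (λ e → val (proj₂ e) ≡ᵇ k) F ≡ᵇ part c k) (range 1 (suc (length c)))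

-- coefficient of x_1^{c_1} ... x_r^{c_r} in Q_{λ/μ}:
-- number of marked shifted tableaux of shape λ/μ~ with content c
qCoeff : List ℕ → List ℕ → List ℕ → ℕ
qCoeff la mu c =
  countB (λ F → isTableau F ∧ hasContent c F)
         (fillings (boxes la mu) (letters (length c)))

-- coefficient of x_1^{c_1} ... x_r^{c_r} in p_ν = ∏_i (Σ_k x_k^{ν_i}):
-- number of maps f : {parts of ν} → {1..r} with Σ_{f(i)=k} ν_i = c_k for all k

maps : ℕ → ℕ → List (List ℕ)
maps zero    r = [] ∷ []
maps (suc l) r = concatMap (λ f → map (λ k → k ∷ f) (range 1 (suc r))) (maps l r)

weightAt : List ℕ → List ℕ → ℕ → ℕ
weightAt []       _        k = 0
weightAt (_ ∷ _)  []       k = 0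
weightAt (v ∷ nu) (x ∷ f)  k = (if x ≡ᵇ k then v else 0) + weightAt nu f k

pCoeff : List ℕ → List ℕ → ℕ
pCoeff nu c =
  countB (λ f → allB (λ k → weightAt nu f k ≡ᵇ part c k) (range 1 (suc (length c))))
         (maps (length nu) (length c))

ℕ→ℚ : ℕ → ℚ
ℕ→ℚ n = (+ n) / 1

sumℚ : List ℚ → ℚ
sumℚ = foldr _+ℚ_ 0ℚ

module Submission where

-- Proof idea (specialisation to one variable).  Compare the coefficients of
-- the monomial x₁ⁿ, n = |λ/μ|, on both sides of Q_{λ/μ} = Σ_ν a_ν p_ν,
-- i.e. evaluate at x₁ = 1, x₂ = x₃ = ⋯ = 0.
--  * Power sums: p_ν(1,0,0,…) = 1 whenever |ν| = n, so the right-hand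
--    coefficient is Σ_ν a_ν.
--  * Tableaux: a tableau of content (n) only uses the letters 1' and 1.
--    In the boxes (i,j), (i,j+1), (i+1,j+1) the middle box cannot hold 1'
--    (the box to its left would then be 1' as well: two 1' in one row), so it
--    holds 1, and so does the box below it: two unmarked 1 in one column.

open import Defs
open import Data.Bool using (Bool; true; false; _∧_)
open import Data.Bool.Properties using (T-≡)
open import Data.List using (List; []; _∷_; map; length)
open import Data.List.Membership.Propositional using (_∈_; find; lose)
open import Data.List.Membership.Propositional.Properties
  using (∈-map⁺; ∈-map⁻; ∈-concatMap⁺; ∈-concatMap⁻; ∈-upTo⁺)
open import Data.List.Properties using (map-cong-local)
open import Data.List.Relation.Unary.All using (tabulate)
open import Data.List.Relation.Unary.Any using (here; there)
open import Data.List.Relation.Unary.Unique.Propositional using (Unique)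
open import Data.Nat using (ℕ; zero; suc; _+_; _≤_; _<_; _≡ᵇ_; _≤ᵇ_; s≤s)
open import Data.Nat.ListAction using (sum)
open import Data.Nat.Properties using (≡⇒≡ᵇ; ≤⇒≤ᵇ; n≤1+n; m+[n∸m]≡n; ∸-monoˡ-<)
open import Data.Product using (Σ; _×_; _,_; proj₁; proj₂)
open import Data.Rational using (ℚ; 0ℚ; _*_)
open import Data.Rational.Properties using (*-identityʳ)
open import Function.Bundles using (Equivalence)
open import Relation.Binary.PropositionalEquality
  using (_≡_; refl; sym; cong; subst; module ≡-Reasoning)

≡ᵇ-refl : ∀ n → (n ≡ᵇ n) ≡ true
≡ᵇ-refl n = Equivalence.to T-≡ (≡⇒≡ᵇ n n refl)

≡ᵇ-suc : ∀ n → (n ≡ᵇ suc n) ≡ false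
≡ᵇ-suc zero    = refl
≡ᵇ-suc (suc n) = ≡ᵇ-suc n

≤ᵇ-suc : ∀ n → (n ≤ᵇ suc n) ≡ true
≤ᵇ-suc n = Equivalence.to T-≡ (≤⇒≤ᵇ (n≤1+n n))

countB-none : {A : Set} (p : A → Bool) (xs : List A) →
  (∀ x → x ∈ xs → p x ≡ false) → countB p xs ≡ 0
countB-none p []       none = refl
countB-none p (x ∷ xs) none rewrite none x (here refl) =
  countB-none p xs (λ y y∈xs → none y (there y∈xs))

allB-sound : {A : Set} (p : A → Bool) (xs : List A) →
  allB p xs ≡ true → ∀ x → x ∈ xs → p x ≡ true
allB-sound p (y ∷ xs) ok x x∈ with p y in py
... | false with () ← ok
... | true with x∈
...   | here refl  = py
...   | there x∈xs = allB-sound p xs ok x x∈xs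

fillings-total : (bs : List Box) (ls : List Letter) (F : Filling) →
  F ∈ fillings bs ls → ∀ b → b ∈ bs → Σ Letter (λ a → a ∈ ls × (b , a) ∈ F)
fillings-total (b′ ∷ bs) ls F F∈ b b∈
  with find (∈-concatMap⁻ (λ G → map (λ a → (b′ , a) ∷ G) ls)
                          {xs = fillings bs ls} F∈)
... | G , G∈ , F∈G with ∈-map⁻ (λ a → (b′ , a) ∷ G) F∈G
... | a , a∈ , refl with b∈
...   | here refl = a , a∈ , here refl
...   | there b∈bs =
  let a′ , a′∈ , b↦a′ = fillings-total bs ls G G∈ b b∈bs
  in  a′ , a′∈ , there b↦a′

range-complete : ∀ a b x → a ≤ x → x < b → x ∈ range a b
range-complete a b x a≤x x<b = subst (_∈ range a b) (m+[n∸m]≡n a≤x)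
  (∈-map⁺ (a +_) (∈-upTo⁺ (∸-monoˡ-< x<b a≤x)))

boxes-complete : ∀ la mu i j → InDiagram la mu i j → (i , j) ∈ boxes la mu
boxes-complete la mu i j (1≤i , i≤ℓ , j-lo , j-hi) =
  ∈-concatMap⁺ (λ i → map (λ j → (i , j)) (range (i + part mu i) (i + part la i)))
    (lose (range-complete 1 (suc (length la)) i 1≤i (s≤s i≤ℓ))
          (∈-map⁺ (λ j → (i , j)) (range-complete _ _ j j-lo j-hi)))

one-letter : ∀ a → a ∈ letters 1 → Σ Bool (λ m → a ≡ (1 , m))
one-letter a (here refl)         = true , refl
one-letter a (there (here refl)) = false , refl

-- Row condition: if (i,j) and (i,j+1) hold letters from {1',1}, the right one
-- is unmarked (1' ≤ 1' forces two 1' in the row; 1 ≤ 1' is false).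
row-right-unmarked : ∀ i j x y →
  pairOK ((i , j) , (1 , x)) ((i , suc j) , (1 , y)) ≡ true → y ≡ false
row-right-unmarked i j x y ok
  rewrite ≡ᵇ-refl i | ≤ᵇ-suc j | ≡ᵇ-suc j with x | y
... | _     | false = refl
... | true  | true  with () ← ok
... | false | true  with () ← ok

-- Column condition: if (i,j) and (i+1,j) hold letters from {1',1}, the top
-- one is marked (otherwise both are unmarked 1 in one column).
column-top-marked : ∀ i j y z →
  pairOK ((i , j) , (1 , y)) ((suc i , j) , (1 , z)) ≡ true → y ≡ true
column-top-marked i j y z ok
  rewrite ≡ᵇ-refl j | ≤ᵇ-suc i | ≡ᵇ-suc i with y | z
... | true  | _     = refl
... | false | true  with () ← ok
... | false | false with () ← ok

qCoeff-one-variable : ∀ la mu i j → InDiagram la mu i j →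
  InDiagram la mu i (suc j) → InDiagram la mu (suc i) (suc j) →
  ∀ n → qCoeff la mu (n ∷ []) ≡ 0
qCoeff-one-variable la mu i j left middle below n =
  countB-none _ (fillings (boxes la mu) (letters 1)) no-tableau
  where
  entry : ∀ {F} → F ∈ fillings (boxes la mu) (letters 1) →
    ∀ {i j} → InDiagram la mu i j → Σ Bool (λ m → ((i , j) , (1 , m)) ∈ F)
  entry F∈ box with fillings-total _ _ _ F∈ _ (boxes-complete la mu _ _ box)
  ... | a , a∈ , b↦a with one-letter a a∈
  ...   | m , refl = m , b↦a

  no-tableau : ∀ F → F ∈ fillings (boxes la mu) (letters 1) →
    (isTableau F ∧ hasContent (n ∷ []) F) ≡ false
  no-tableau F F∈ with isTableau F in tableau
  ... | false = refl
  ... | true with entry F∈ left | entry F∈ middle | entry F∈ below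
  ...   | x , at-left | y , at-middle | z , at-below
    with row-right-unmarked i j x y (pairs-ok at-left at-middle)
       | column-top-marked i (suc j) y z (pairs-ok at-middle at-below)
    where
    pairs-ok : ∀ {p q} → p ∈ F → q ∈ F → pairOK p q ≡ true
    pairs-ok p∈ q∈ = allB-sound _ F (allB-sound _ F tableau _ p∈) _ q∈
  ...   | refl | ()

constant-one : ℕ → List ℕ
constant-one zero    = []
constant-one (suc l) = 1 ∷ constant-one l

maps-into-one : ∀ l → maps l 1 ≡ constant-one l ∷ []
maps-into-one zero = refl
maps-into-one (suc l) rewrite maps-into-one l = refl

weightAt-constant-one : ∀ nu → weightAt nu (constant-one (length nu)) 1 ≡ sum nu
weightAt-constant-one []       = refl
weightAt-constant-one (v ∷ nu) = cong (v +_) (weightAt-constant-one nu)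

-- Power-sum side of the evaluation: p_ν(x₁) = x₁^{|ν|}, so the coefficient
-- of x₁ⁿ in p_ν is 1 when |ν| = n.
pCoeff-one-variable : ∀ nu n → sum nu ≡ n → pCoeff nu (n ∷ []) ≡ 1
pCoeff-one-variable nu n |ν|≡n
  rewrite maps-into-one (length nu) | weightAt-constant-one nu | |ν|≡n | ≡ᵇ-refl n
  = refl

lemma4p3 : (la mu : List ℕ) → StrictPartition la → StrictPartition mu → mu ⊆ₚ la →
    (i j : ℕ) → InDiagram la mu i j → InDiagram la mu i (suc j) →
    InDiagram la mu (suc i) (suc j) →
    (ops : List (List ℕ)) → Unique ops →
    (∀ nu → (nu ∈ ops → IsOddPartition (size la mu) nu) × (IsOddPartition (size la mu) nu → nu ∈ ops)) →
    (a : List ℕ → ℚ) →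
    (∀ c → ℕ→ℚ (qCoeff la mu c) ≡ sumℚ (map (λ nu → a nu * ℕ→ℚ (pCoeff nu c)) ops)) →
    sumℚ (map a ops) ≡ 0ℚ
lemma4p3 la mu _ _ _ i j left middle below ops _ ops-spec a expansion = begin
  sumℚ (map a ops)                                        ≡⟨ cong sumℚ (map-cong-local (tabulate p-at-x₁ⁿ)) ⟩
  sumℚ (map (λ nu → a nu * ℕ→ℚ (pCoeff nu (n ∷ []))) ops) ≡⟨ sym (expansion (n ∷ [])) ⟩
  ℕ→ℚ (qCoeff la mu (n ∷ []))                              ≡⟨ cong ℕ→ℚ (qCoeff-one-variable la mu i j left middle below n) ⟩
  0ℚ                                                      ∎
  where
  open ≡-Reasoning
  n = size la mu
  -- every ν in the list has |ν| = n, so its coefficient at x₁ⁿ is 1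
  p-at-x₁ⁿ : ∀ {nu} → nu ∈ ops → a nu ≡ a nu * ℕ→ℚ (pCoeff nu (n ∷ []))
  p-at-x₁ⁿ {nu} nu∈ = begin
    a nu                               ≡⟨ sym (*-identityʳ (a nu)) ⟩
    a nu * ℕ→ℚ 1                       ≡⟨ cong (λ k → a nu * ℕ→ℚ k) (sym (pCoeff-one-variable nu n |ν|≡n)) ⟩
    a nu * ℕ→ℚ (pCoeff nu (n ∷ []))    ∎
    where |ν|≡n = proj₂ (proj₂ (proj₁ (ops-spec nu) nu∈))
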